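{- Let $G$ be a finite non-cyclic abelian $2$-group. Then $\Gamma(G)$ is a cograph if and only if the exponent of $G$ is at most $4$.
   Context: For a finite group $G$, the prime-order element graph $\Gamma(G)$ is the simple graph with vertex set $G$ in which two distinct vertices $x,y$ are adjacent if and only if the order of $xy$ is a prime. A cograph is a graph with no induced path on four vertices. -}

module Defs where

open import Level using (0ℓ)
open import Data.Nat using (ℕ; zero; suc; _≤_; _<_; _^_)
open import Data.Nat.Primality using (Prime)
open import Data.Fin using (Fin)
open import Data.Product using (Σ; ∃; _×_; _,_)
open import Relation.Binary.PropositionalEquality using (_≡_; _≢_)
open import Relation.Nullary using (¬_)
open import Algebra.Structures using (IsAbelianGroup)

-- A finite abelian group, presented (up to isomorphism) on the carrier Fin n
-- with propositional equality.
record FiniteAbelianGroup : Set where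
  field
    n     : ℕ
    _∙_   : Fin n → Fin n → Fin n
    ε     : Fin n
    _⁻¹   : Fin n → Fin n
    isAbelianGroup : IsAbelianGroup _≡_ _∙_ ε _⁻¹

module _ (G : FiniteAbelianGroup) where
  open FiniteAbelianGroup G

  Elem : Set
  Elem = Fin n

  order : ℕ
  order = n

  pow : Elem → ℕ → Elem
  pow x zero    = ε
  pow x (suc k) = x ∙ pow x k

  HasOrder : Elem → ℕ → Set
  HasOrder x k = 1 ≤ k × pow x k ≡ ε × (∀ m → 1 ≤ m → m < k → pow x m ≢ ε)

  Is2Group : Set
  Is2Group = ∃ λ k → order ≡ 2 ^ k

  IsCyclic : Set
  IsCyclic = ∃ λ g → ∀ x → ∃ λ k → x ≡ pow g k

  IsExponent : ℕ → Set
  IsExponent e = 1 ≤ e × (∀ x → pow x e ≡ ε)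
               × (∀ m → 1 ≤ m → m < e → ¬ (∀ x → pow x m ≡ ε))

  -- Prime-order element graph Γ(G): distinct x,y adjacent iff o(xy) is prime
  Adj : Elem → Elem → Set
  Adj x y = x ≢ y × ∃ λ p → Prime p × HasOrder (x ∙ y) p

  InducedP4 : Elem → Elem → Elem → Elem → Set
  InducedP4 a b c d =
    (a ≢ b × a ≢ c × a ≢ d × b ≢ c × b ≢ d × c ≢ d)
    × (Adj a b × Adj b c × Adj c d)
    × (¬ Adj a c × ¬ Adj b d × ¬ Adj a d)

  IsCograph : Set
  IsCograph = ¬ (Σ Elem λ a → Σ Elem λ b → Σ Elem λ c → Σ Elem λ d → InducedP4 a b c d)

-- In a 2-group every element of prime order is an involution, so x — y exactly when x ≢ y and
-- x ∙ y is an involution. If x ^ 4 ≡ ε for all x, squares are self-inverse, so the square map is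
-- constant along edges, and two distinct non-adjacent vertices with equal squares are mutually
-- inverse; on a path a — b — c — d this forces c ≡ a ⁻¹ ≡ d. Otherwise fix h with h ^ 4 ≢ ε: two
-- distinct involutions t, z would give the induced path h — h ⁻¹ ∙ t — h ∙ z — h ⁻¹, so a cograph
-- has a unique involution. Then an element g of maximal order generates: if sq x is a power of g,
-- it is an even one g ^ (2q), and x ∙ g ^ -q is ε or the unique involution, itself a power of g.

module Submission where

open import Level using (0ℓ)
open import Algebra.Bundles using (AbelianGroup)
open import Data.Empty using (⊥-elim)
open import Data.Fin using (_≟_)
open import Data.Fin.Permutation using (Permutation; permutation)
open import Data.Fin.Properties using (all?; ¬∀⟶∃¬)
open import Data.Nat using (ℕ; zero; suc; _+_; _*_; _≤_; _<_; _^_; z≤n; s≤s; NonZero)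
open import Data.Nat.DivMod using (_%_; _/_; m≡m%n+[m/n]*n; m%n<n)
open import Data.Nat.Divisibility using (_∣_; divides; ∣1⇒≡1; ∣-refl; m%n≡0⇒n∣m)
open import Data.Nat.Primality using (Prime; prime?; euclidsLemma; prime⇒irreducible; prime[2]; ¬prime[1])
open import Data.Nat.Properties using (≮⇒≥; +-comm; +-suc; *-comm; m<1+n⇒m<n∨m≡n)
open import Data.Product using (Σ; ∃; ∃₂; _×_; _,_; proj₁; proj₂)
open import Data.Sum using (_⊎_; inj₁; inj₂)
open import Data.Vec.Functional using (replicate)
open import Function using (_∘_; id)
open import Function.Bundles using (_⇔_; mk⇔; Equivalence)
open import Relation.Binary.PropositionalEquality
open import Relation.Nullary using (¬_; yes; no; contradiction)
open import Relation.Nullary.Decidable using (from-yes)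
open import Relation.Unary using (Decidable)

open import Defs

-- HasOrder G x and IsExponent G are, definitionally, LeastPositive of the annihilation predicates.
LeastPositive : (ℕ → Set) → ℕ → Set
LeastPositive P e = 1 ≤ e × P e × (∀ m → 1 ≤ m → m < e → ¬ P m)

least-positive : {P : ℕ → Set} → Decidable P → ∀ {N} → 1 ≤ N → P N → ∃ (LeastPositive P)
least-positive {P} P? {suc n} _ P[1+n] =
  search n 0 (λ { zero () ; (suc _) _ (s≤s ()) }) (subst P (+-comm 1 n) P[1+n])
  where
  search : ∀ d k → (∀ m → 1 ≤ m → m < suc k → ¬ P m) → P (d + suc k) → ∃ (LeastPositive P)
  search zero    k below P[1+k] = suc k , s≤s z≤n , P[1+k] , below
  search (suc d) k below P[1+d+1+k] with P? (suc k)
  ... | yes P[1+k] = suc k , s≤s z≤n , P[1+k] , below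
  ... | no ¬P[1+k] = search d (suc k) below′ (subst P (sym (+-suc d (suc k))) P[1+d+1+k])
    where
    below′ : ∀ m → 1 ≤ m → m < suc (suc k) → ¬ P m
    below′ m 1≤m m<2+k with m<1+n⇒m<n∨m≡n m<2+k
    ... | inj₁ m<1+k = below m 1≤m m<1+k
    ... | inj₂ refl  = ¬P[1+k]

LeastPositive-≤ : ∀ {P e N} → LeastPositive P e → 1 ≤ N → P N → e ≤ N
LeastPositive-≤ (_ , _ , minimal) 1≤N P[N] = ≮⇒≥ (λ N<e → minimal _ 1≤N N<e P[N])

LeastPositive-∣ : ∀ {P e a} → (∀ a b .{{_ : NonZero b}} → P a → P b → P (a % b)) →
                  LeastPositive P e → P a → e ∣ a
LeastPositive-∣ {P} {suc e} {a} %-closed (_ , P[1+e] , minimal) P[a]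
  with a % suc e in a%[1+e]≡r | %-closed a (suc e) P[a] P[1+e]
... | zero  | _      = m%n≡0⇒n∣m a (suc e) a%[1+e]≡r
... | suc r | P[1+r] = ⊥-elim (minimal (suc r) (s≤s z≤n) (subst (_< suc e) a%[1+e]≡r (m%n<n a (suc e))) P[1+r])

prime∣prime^k⇒≡ : ∀ {p q} k → Prime p → Prime q → p ∣ q ^ k → p ≡ q
prime∣prime^k⇒≡ zero    p-prime _ p∣1 = contradiction (subst Prime (∣1⇒≡1 p∣1) p-prime) ¬prime[1]
prime∣prime^k⇒≡ {q = q} (suc k) p-prime q-prime p∣q^[1+k] with euclidsLemma q (q ^ k) p-prime p∣q^[1+k]
... | inj₂ p∣q^k = prime∣prime^k⇒≡ k p-prime q-prime p∣q^k
... | inj₁ p∣q with prime⇒irreducible q-prime p∣q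
...   | inj₁ refl = contradiction p-prime ¬prime[1]
...   | inj₂ p≡q  = p≡q

∣2^k⇒∣4 : ∀ {e} k → e ∣ 2 ^ k → 1 ≤ e → e ≤ 4 → e ∣ 4
∣2^k⇒∣4 {1} _ _ _ _ = divides 4 refl
∣2^k⇒∣4 {2} _ _ _ _ = divides 2 refl
∣2^k⇒∣4 {3} k 3∣2^k _ _ with () ← prime∣prime^k⇒≡ k (from-yes (prime? 3)) prime[2] 3∣2^k
∣2^k⇒∣4 {4} _ _ _ _ = ∣-refl
∣2^k⇒∣4 {suc (suc (suc (suc (suc _))))} _ _ _ (s≤s (s≤s (s≤s (s≤s ()))))

even⊎odd : ∀ i → Σ ℕ λ q → i ≡ q * 2 ⊎ i ≡ suc (q * 2)
even⊎odd zero = 0 , inj₁ refl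
even⊎odd (suc i) with even⊎odd i
... | q , inj₁ refl = q , inj₂ refl
... | q , inj₂ refl = suc q , inj₁ refl

module _ (G : FiniteAbelianGroup) where
  open FiniteAbelianGroup G using (n; isAbelianGroup)

  abelianGroup : AbelianGroup 0ℓ 0ℓ
  abelianGroup = record { isAbelianGroup = isAbelianGroup }

  open AbelianGroup abelianGroup
    using ( _∙_; ε; _⁻¹; assoc; identityˡ; identityʳ; inverseˡ; inverseʳ
          ; commutativeMonoid; commutativeSemigroup)
  open import Algebra.Properties.AbelianGroup abelianGroup
    using ( ∙-cancelˡ; ∙-cancelʳ; inverseʳ-unique; ⁻¹-∙-comm; ⁻¹-injective; ε⁻¹≈ε; xyx⁻¹≈y
          ; //-rightDividesˡ; x≈y⇒x∙y⁻¹≈ε)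
  open import Algebra.Properties.CommutativeSemigroup commutativeSemigroup using (interchange)
  open import Algebra.Properties.CommutativeMonoid.Mult commutativeMonoid
    using (×-homo-+; ×-assocˡ; ×-distrib-+) renaming (_×_ to _·_)
  open import Algebra.Properties.CommutativeMonoid.Sum commutativeMonoid
    using (sum; sum-permute; sum-replicate; ∑-distrib-+)
  open ≡-Reasoning

  infixl 8 _^ᴳ_
  _^ᴳ_ : Elem G → ℕ → Elem G
  x ^ᴳ k = pow G x k

  pow≡· : ∀ x k → x ^ᴳ k ≡ k · x
  pow≡· x zero    = refl
  pow≡· x (suc k) = cong (x ∙_) (pow≡· x k)

  pow-+ : ∀ x a b → x ^ᴳ (a + b) ≡ x ^ᴳ a ∙ x ^ᴳ b
  pow-+ x a b rewrite pow≡· x (a + b) | pow≡· x a | pow≡· x b = ×-homo-+ x a b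

  pow-* : ∀ x a b → x ^ᴳ (a * b) ≡ (x ^ᴳ b) ^ᴳ a
  pow-* x a b rewrite pow≡· x (a * b) | pow≡· x b | pow≡· (b · x) a = sym (×-assocˡ x a b)

  pow-∙ : ∀ x y a → (x ∙ y) ^ᴳ a ≡ x ^ᴳ a ∙ y ^ᴳ a
  pow-∙ x y a rewrite pow≡· (x ∙ y) a | pow≡· x a | pow≡· y a = ×-distrib-+ x y a

  ε-pow : ∀ a → ε ^ᴳ a ≡ ε
  ε-pow zero    = refl
  ε-pow (suc a) = trans (identityˡ _) (ε-pow a)

  pow-1 : ∀ x → x ^ᴳ 1 ≡ x
  pow-1 = identityʳ

  pow-∣ : ∀ {x e a} → e ∣ a → x ^ᴳ e ≡ ε → x ^ᴳ a ≡ ε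
  pow-∣ {x} {e} (divides q refl) x^e≡ε = trans (pow-* x q e) (trans (cong (_^ᴳ q) x^e≡ε) (ε-pow q))

  pow-% : ∀ x a b .{{_ : NonZero b}} → x ^ᴳ a ≡ ε → x ^ᴳ b ≡ ε → x ^ᴳ (a % b) ≡ ε
  pow-% x a b x^a≡ε x^b≡ε = begin
    x ^ᴳ (a % b)                          ≡⟨ identityʳ _ ⟨
    x ^ᴳ (a % b) ∙ ε                      ≡⟨ cong (x ^ᴳ (a % b) ∙_) (pow-∣ (divides (a / b) refl) x^b≡ε) ⟨
    x ^ᴳ (a % b) ∙ x ^ᴳ ((a / b) * b)     ≡⟨ pow-+ x (a % b) _ ⟨
    x ^ᴳ (a % b + (a / b) * b)            ≡⟨ cong (x ^ᴳ_) (m≡m%n+[m/n]*n a b) ⟨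
    x ^ᴳ a                                ≡⟨ x^a≡ε ⟩
    ε                                     ∎

  -- Multiplying all elements by s permutes them, so s ^ |G| ∙ Π G = Π G.
  pow-order≡ε : ∀ s → s ^ᴳ order G ≡ ε
  pow-order≡ε s = trans (pow≡· s n) (∙-cancelʳ (sum id) (n · s) ε (begin
    n · s ∙ sum id                  ≡⟨ cong (_∙ sum id) (sum-replicate n) ⟨
    sum (replicate n s) ∙ sum id    ≡⟨ ∑-distrib-+ (replicate n s) id ⟨
    sum (s ∙_)                      ≡⟨ sum-permute id translation ⟨
    sum id                          ≡⟨ identityˡ _ ⟨
    ε ∙ sum id                      ∎))
    where
    translation : Permutation n n
    translation = permutation (s ∙_) (s ⁻¹ ∙_)
      (λ x → trans (sym (assoc _ _ _)) (trans (cong (_∙ x) (inverseʳ s)) (identityˡ x)))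
      (λ x → trans (sym (assoc _ _ _)) (trans (cong (_∙ x) (inverseˡ s)) (identityˡ x)))

  order∣ : ∀ {x p a} → HasOrder G x p → x ^ᴳ a ≡ ε → p ∣ a
  order∣ {x} = LeastPositive-∣ (pow-% x)

  exponent∣ : ∀ {e a} → IsExponent G e → (∀ x → x ^ᴳ a ≡ ε) → e ∣ a
  exponent∣ = LeastPositive-∣ (λ a b P[a] P[b] x → pow-% x a b (P[a] x) (P[b] x))

  sq : Elem G → Elem G
  sq x = x ∙ x

  sq-∙ : ∀ x y → sq (x ∙ y) ≡ sq x ∙ sq y
  sq-∙ x y = interchange x y x y

  sq-⁻¹ : ∀ x → sq (x ⁻¹) ≡ sq x ⁻¹
  sq-⁻¹ x = ⁻¹-∙-comm x x

  pow-2 : ∀ x → x ^ᴳ 2 ≡ sq x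
  pow-2 x = cong (x ∙_) (identityʳ x)

  sq-pow : ∀ x q → sq (x ^ᴳ q) ≡ x ^ᴳ (q * 2)
  sq-pow x q = begin
    sq (x ^ᴳ q)     ≡⟨ pow-∙ x x q ⟨
    sq x ^ᴳ q       ≡⟨ cong (_^ᴳ q) (pow-2 x) ⟨
    x ^ᴳ 2 ^ᴳ q     ≡⟨ pow-* x q 2 ⟨
    x ^ᴳ (q * 2)    ∎

  pow-2^suc : ∀ x j → x ^ᴳ (2 ^ suc j) ≡ sq x ^ᴳ (2 ^ j)
  pow-2^suc x j = begin
    x ^ᴳ (2 * 2 ^ j)     ≡⟨ cong (x ^ᴳ_) (*-comm 2 (2 ^ j)) ⟩
    x ^ᴳ (2 ^ j * 2)     ≡⟨ pow-* x (2 ^ j) 2 ⟩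
    x ^ᴳ 2 ^ᴳ (2 ^ j)    ≡⟨ cong (_^ᴳ (2 ^ j)) (pow-2 x) ⟩
    sq x ^ᴳ (2 ^ j)      ∎

  pow-4 : ∀ x → x ^ᴳ 4 ≡ sq (sq x)
  pow-4 x = trans (pow-* x 2 2) (trans (pow-2 (x ^ᴳ 2)) (cong sq (pow-2 x)))

  IsInvolution : Elem G → Set
  IsInvolution t = t ≢ ε × sq t ≡ ε

  involution⇔order-2 : ∀ {t} → IsInvolution t ⇔ HasOrder G t 2
  involution⇔order-2 {t} = mk⇔
    (λ (t≢ε , sq[t]≡ε) → s≤s z≤n , trans (pow-2 t) sq[t]≡ε ,
       λ { zero () ; (suc zero) _ _ t^1≡ε → t≢ε (trans (sym (pow-1 t)) t^1≡ε)
         ; (suc (suc _)) _ (s≤s (s≤s ())) })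
    (λ (_ , t^2≡ε , minimal) →
       (λ t≡ε → minimal 1 (s≤s z≤n) (s≤s (s≤s z≤n)) (trans (pow-1 t) t≡ε)) , trans (sym (pow-2 t)) t^2≡ε)

  adj-if-involution : ∀ {x y} → x ≢ y → IsInvolution (x ∙ y) → Adj G x y
  adj-if-involution x≢y inv = x≢y , 2 , prime[2] , Equivalence.to involution⇔order-2 inv

  trivial⊎exponent-attained : ∀ j → (∀ x → x ^ᴳ (2 ^ j) ≡ ε) →
    (∀ x → x ≡ ε) ⊎ ∃₂ λ m g → g ^ᴳ (2 ^ m) ≢ ε × (∀ x → x ^ᴳ (2 ^ suc m) ≡ ε)
  trivial⊎exponent-attained zero    pow≡ε = inj₁ (λ x → trans (sym (pow-1 x)) (pow≡ε x))
  trivial⊎exponent-attained (suc j) pow≡ε with all? (λ x → x ^ᴳ (2 ^ j) ≟ ε)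
  ... | yes pow≡ε′ = trivial⊎exponent-attained j pow≡ε′
  ... | no  pow≢ε  = let (g , g^2^j≢ε) = ¬∀⟶∃¬ n _ (λ x → x ^ᴳ (2 ^ j) ≟ ε) pow≢ε in
                     inj₂ (j , g , g^2^j≢ε , pow≡ε)

  module _ (unique-involution : ∀ {t z} → IsInvolution t → IsInvolution z → t ≡ z)
           {m g} (g^N≢ε : g ^ᴳ (2 ^ m) ≢ ε) (pow≡ε : ∀ x → x ^ᴳ (2 ^ suc m) ≡ ε) where
    private
      N : ℕ
      N = 2 ^ m

    square-≢-odd-power : ∀ x q → sq x ≢ g ^ᴳ suc (q * 2)
    square-≢-odd-power x q sq[x]≡ = g^N≢ε (begin
      g ^ᴳ N                          ≡⟨ identityʳ _ ⟨
      g ^ᴳ N ∙ ε                      ≡⟨ cong (g ^ᴳ N ∙_) g^[2q]^N≡ε ⟨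
      g ^ᴳ N ∙ g ^ᴳ (q * 2) ^ᴳ N      ≡⟨ pow-∙ g _ N ⟨
      g ^ᴳ suc (q * 2) ^ᴳ N           ≡⟨ cong (_^ᴳ N) sq[x]≡ ⟨
      sq x ^ᴳ N                       ≡⟨ pow-2^suc x m ⟨
      x ^ᴳ (2 ^ suc m)                ≡⟨ pow≡ε x ⟩
      ε                               ∎)
      where
      g^[2q]^N≡ε : g ^ᴳ (q * 2) ^ᴳ N ≡ ε
      g^[2q]^N≡ε = begin
        g ^ᴳ (q * 2) ^ᴳ N     ≡⟨ cong (_^ᴳ N) (sq-pow g q) ⟨
        sq (g ^ᴳ q) ^ᴳ N      ≡⟨ pow-2^suc (g ^ᴳ q) m ⟨
        g ^ᴳ q ^ᴳ (2 ^ suc m) ≡⟨ pow≡ε (g ^ᴳ q) ⟩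
        ε                     ∎

    powers-exhaust : ∀ j x → x ^ᴳ (2 ^ j) ≡ ε → ∃ λ i → x ≡ g ^ᴳ i
    powers-exhaust zero    x x^1≡ε = 0 , trans (sym (pow-1 x)) x^1≡ε
    powers-exhaust (suc j) x x^2^[1+j]≡ε
      with powers-exhaust j (sq x) (trans (sym (pow-2^suc x j)) x^2^[1+j]≡ε)
    ... | i , sq[x]≡g^i with even⊎odd i
    ... | q , inj₂ refl = ⊥-elim (square-≢-odd-power x q sq[x]≡g^i)
    ... | q , inj₁ refl = let (r , y≡g^r) = involution-or-ε-is-power in r + q , (begin
      x                     ≡⟨ //-rightDividesˡ (g ^ᴳ q) x ⟨
      y ∙ g ^ᴳ q            ≡⟨ cong (_∙ g ^ᴳ q) y≡g^r ⟩
      g ^ᴳ r ∙ g ^ᴳ q       ≡⟨ pow-+ g r q ⟨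
      g ^ᴳ (r + q)          ∎)
      where
      y : Elem G
      y = x ∙ (g ^ᴳ q) ⁻¹

      sq[y]≡ε : sq y ≡ ε
      sq[y]≡ε = begin
        sq y                            ≡⟨ sq-∙ x _ ⟩
        sq x ∙ sq ((g ^ᴳ q) ⁻¹)         ≡⟨ cong (sq x ∙_) (sq-⁻¹ (g ^ᴳ q)) ⟩
        sq x ∙ sq (g ^ᴳ q) ⁻¹           ≡⟨ x≈y⇒x∙y⁻¹≈ε (trans sq[x]≡g^i (sym (sq-pow g q))) ⟩
        ε                               ∎

      involution-or-ε-is-power : ∃ λ r → y ≡ g ^ᴳ r
      involution-or-ε-is-power with y ≟ ε
      ... | yes y≡ε = 0 , y≡ε
      ... | no  y≢ε = N , unique-involution (y≢ε , sq[y]≡ε) (g^N≢ε , g^N-sq)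
        where
        g^N-sq : sq (g ^ᴳ N) ≡ ε
        g^N-sq = trans (sym (pow-∙ g g N)) (trans (sym (pow-2^suc g m)) (pow≡ε g))

  module _ (two-group : Is2Group G) where
    private
      k : ℕ
      k = proj₁ two-group

    pow-2^k≡ε : ∀ x → x ^ᴳ (2 ^ k) ≡ ε
    pow-2^k≡ε x = subst (λ m → x ^ᴳ m ≡ ε) (proj₂ two-group) (pow-order≡ε x)

    prime-order≡2 : ∀ {x p} → HasOrder G x p → Prime p → p ≡ 2
    prime-order≡2 {x} x-order p-prime = prime∣prime^k⇒≡ k p-prime prime[2] (order∣ x-order (pow-2^k≡ε x))

    involution-if-adj : ∀ {x y} → Adj G x y → IsInvolution (x ∙ y)
    involution-if-adj (_ , p , p-prime , xy-order) with prime-order≡2 xy-order p-prime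
    ... | refl = Equivalence.from involution⇔order-2 xy-order

    adj⇒sq∙sq≡ε : ∀ {x y} → Adj G x y → sq x ∙ sq y ≡ ε
    adj⇒sq∙sq≡ε {x} {y} adj = trans (sym (sq-∙ x y)) (proj₂ (involution-if-adj adj))

    ¬adj-if-sq∙sq≢ε : ∀ {x y} → sq x ∙ sq y ≢ ε → ¬ Adj G x y
    ¬adj-if-sq∙sq≢ε sq∙sq≢ε = sq∙sq≢ε ∘ adj⇒sq∙sq≡ε

    has-exponent≤4⇔pow4≡ε : (∃ λ e → IsExponent G e × e ≤ 4) ⇔ (∀ x → x ^ᴳ 4 ≡ ε)
    has-exponent≤4⇔pow4≡ε = mk⇔
      (λ (e , exponent@(1≤e , pow-e≡ε , _) , e≤4) x →
         pow-∣ {e = e} (∣2^k⇒∣4 k (exponent∣ exponent pow-2^k≡ε) 1≤e e≤4) (pow-e≡ε x))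
      (λ pow4≡ε → let (e , exponent) = least-positive P? {4} (s≤s z≤n) pow4≡ε in
                  e , exponent , LeastPositive-≤ {N = 4} exponent (s≤s z≤n) pow4≡ε)
      where
      P? : Decidable (λ m → ∀ x → x ^ᴳ m ≡ ε)
      P? m = all? (λ x → x ^ᴳ m ≟ ε)

    cograph-if-pow4≡ε : (∀ x → x ^ᴳ 4 ≡ ε) → IsCograph G
    cograph-if-pow4≡ε pow4≡ε
      (a , b , c , d , (_ , a≢c , a≢d , _ , _ , c≢d) , (ab , bc , cd) , (¬ac , _ , ¬ad)) =
      c≢d (trans (nonadjacent⇒inverse a≢c ¬ac (trans (adj⇒sq≡ ab) (adj⇒sq≡ bc)))
          (sym (nonadjacent⇒inverse a≢d ¬ad (trans (adj⇒sq≡ ab) (trans (adj⇒sq≡ bc) (adj⇒sq≡ cd))))))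
      where
      sq-self-inverse : ∀ x → sq x ≡ sq x ⁻¹
      sq-self-inverse x = inverseʳ-unique (sq x) (sq x) (trans (sym (pow-4 x)) (pow4≡ε x))

      adj⇒sq≡ : ∀ {x y} → Adj G x y → sq x ≡ sq y
      adj⇒sq≡ {x} {y} adj = begin
        sq x       ≡⟨ sq-self-inverse x ⟩
        sq x ⁻¹    ≡⟨ inverseʳ-unique (sq x) (sq y) (adj⇒sq∙sq≡ε adj) ⟨
        sq y       ∎

      nonadjacent⇒inverse : ∀ {x y} → x ≢ y → ¬ Adj G x y → sq x ≡ sq y → y ≡ x ⁻¹
      nonadjacent⇒inverse {x} {y} x≢y ¬adj sq[x]≡sq[y] with x ∙ y ≟ ε
      ... | yes xy≡ε = inverseʳ-unique x y xy≡ε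
      ... | no  xy≢ε = ⊥-elim (¬adj (adj-if-involution x≢y (xy≢ε , sq[xy]≡ε)))
        where
        sq[xy]≡ε : sq (x ∙ y) ≡ ε
        sq[xy]≡ε = begin
          sq (x ∙ y)          ≡⟨ sq-∙ x y ⟩
          sq x ∙ sq y         ≡⟨ cong (sq x ∙_) (trans (sym sq[x]≡sq[y]) (sq-self-inverse x)) ⟩
          sq x ∙ sq x ⁻¹      ≡⟨ inverseʳ (sq x) ⟩
          ε                   ∎

    -- With u = sq h, the squares of h, h ⁻¹ ∙ t, h ∙ z, h ⁻¹ are u, u ⁻¹, u, u ⁻¹, and
    -- u ≢ u ⁻¹ separates the vertices and rules out the chords.
    inducedP4 : ∀ {h t z} → sq (sq h) ≢ ε → IsInvolution t → IsInvolution z → t ≢ z →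
                InducedP4 G h (h ⁻¹ ∙ t) (h ∙ z) (h ⁻¹)
    inducedP4 {h} {t} {z} sq[u]≢ε (t≢ε , sq[t]≡ε) (z≢ε , sq[z]≡ε) t≢z =
      (a≢b , a≢c , a≢d , b≢c , b≢d , c≢d)
      , ( adj-via a≢b ab≡t (t≢ε , sq[t]≡ε)
        , adj-via b≢c bc≡tz (tz≢ε , sq[tz]≡ε)
        , adj-via c≢d (xyx⁻¹≈y h z) (z≢ε , sq[z]≡ε))
      , ( ¬adj-if-sq∙sq≢ε (subst (_≢ ε) (cong (u ∙_) (sym sq[c])) sq[u]≢ε)
        , ¬adj-if-sq∙sq≢ε (subst (_≢ ε) (cong₂ _∙_ (sym sq[b]) (sym (sq-⁻¹ h))) u⁻¹∙u⁻¹≢ε)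
        , λ adj → proj₁ (involution-if-adj adj) (inverseʳ h))
      where
      u : Elem G
      u = sq h

      separated : ∀ {x y} → sq x ≡ u → sq y ≡ u ⁻¹ → x ≢ y
      separated sq[x] sq[y] x≡y = sq[u]≢ε (begin
        u ∙ u       ≡⟨ cong (u ∙_) (trans (sym sq[x]) (trans (cong sq x≡y) sq[y])) ⟩
        u ∙ u ⁻¹    ≡⟨ inverseʳ u ⟩
        ε           ∎)

      x≢x∙y : ∀ {x y} → y ≢ ε → x ≢ x ∙ y
      x≢x∙y {x} y≢ε x≡xy = y≢ε (sym (∙-cancelˡ x ε _ (trans (identityʳ x) x≡xy)))

      adj-via : ∀ {x y w} → x ≢ y → x ∙ y ≡ w → IsInvolution w → Adj G x y
      adj-via x≢y xy≡w inv = adj-if-involution x≢y (subst IsInvolution (sym xy≡w) inv)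

      sq[b] : sq (h ⁻¹ ∙ t) ≡ u ⁻¹
      sq[b] = trans (sq-∙ (h ⁻¹) t) (trans (cong₂ _∙_ (sq-⁻¹ h) sq[t]≡ε) (identityʳ _))

      sq[c] : sq (h ∙ z) ≡ u
      sq[c] = trans (sq-∙ h z) (trans (cong (u ∙_) sq[z]≡ε) (identityʳ u))

      a≢b : h ≢ h ⁻¹ ∙ t
      a≢b = separated refl sq[b]

      a≢c : h ≢ h ∙ z
      a≢c = x≢x∙y z≢ε

      a≢d : h ≢ h ⁻¹
      a≢d = separated refl (sq-⁻¹ h)

      b≢c : h ⁻¹ ∙ t ≢ h ∙ z
      b≢c b≡c = separated sq[c] sq[b] (sym b≡c)

      b≢d : h ⁻¹ ∙ t ≢ h ⁻¹
      b≢d b≡d = x≢x∙y t≢ε (sym b≡d)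

      c≢d : h ∙ z ≢ h ⁻¹
      c≢d = separated sq[c] (sq-⁻¹ h)

      u⁻¹∙u⁻¹≢ε : u ⁻¹ ∙ u ⁻¹ ≢ ε
      u⁻¹∙u⁻¹≢ε e = sq[u]≢ε (⁻¹-injective (begin
        (u ∙ u) ⁻¹      ≡⟨ ⁻¹-∙-comm u u ⟨
        u ⁻¹ ∙ u ⁻¹     ≡⟨ e ⟩
        ε               ≡⟨ ε⁻¹≈ε ⟨
        ε ⁻¹            ∎))

      ab≡t : h ∙ (h ⁻¹ ∙ t) ≡ t
      ab≡t = trans (sym (assoc h (h ⁻¹) t)) (trans (cong (_∙ t) (inverseʳ h)) (identityˡ t))

      bc≡tz : (h ⁻¹ ∙ t) ∙ (h ∙ z) ≡ t ∙ z
      bc≡tz = trans (interchange (h ⁻¹) t h z) (trans (cong (_∙ (t ∙ z)) (inverseˡ h)) (identityˡ _))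

      tz≢ε : t ∙ z ≢ ε
      tz≢ε tz≡ε = t≢z (trans (inverseʳ-unique t t sq[t]≡ε) (sym (inverseʳ-unique t z tz≡ε)))

      sq[tz]≡ε : sq (t ∙ z) ≡ ε
      sq[tz]≡ε = trans (sq-∙ t z) (trans (cong₂ _∙_ sq[t]≡ε sq[z]≡ε) (identityˡ ε))

    cyclic-if-unique-involution : (∀ {t z} → IsInvolution t → IsInvolution z → t ≡ z) → IsCyclic G
    cyclic-if-unique-involution unique-involution with trivial⊎exponent-attained k pow-2^k≡ε
    ... | inj₁ trivial = ε , λ x → 0 , trivial x
    ... | inj₂ (m , g , g^N≢ε , pow≡ε) =
      g , λ x → powers-exhaust unique-involution {m} g^N≢ε pow≡ε (suc m) x (pow≡ε x)

    pow4≡ε-if-cograph : ¬ IsCyclic G → IsCograph G → ∀ h → h ^ᴳ 4 ≡ ε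
    pow4≡ε-if-cograph ¬cyclic cograph h with h ^ᴳ 4 ≟ ε
    ... | yes h^4≡ε = h^4≡ε
    ... | no  h^4≢ε = ⊥-elim (¬cyclic (cyclic-if-unique-involution unique-involution))
      where
      unique-involution : ∀ {t z} → IsInvolution t → IsInvolution z → t ≡ z
      unique-involution {t} {z} t-inv z-inv with t ≟ z
      ... | yes t≡z = t≡z
      ... | no  t≢z = ⊥-elim (cograph (_ , _ , _ , _ , inducedP4 (h^4≢ε ∘ trans (pow-4 h)) t-inv z-inv t≢z))

mainTheorem13 : (G : FiniteAbelianGroup) → Is2Group G → ¬ IsCyclic G →
    (IsCograph G ⇔ (∃ λ e → IsExponent G e × e ≤ 4))
mainTheorem13 G two-group ¬cyclic = mk⇔
  (from ∘ pow4≡ε-if-cograph G two-group ¬cyclic)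
  (cograph-if-pow4≡ε G two-group ∘ to)
  where open Equivalence (has-exponent≤4⇔pow4≡ε G two-group)
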